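{- Let $r\ge 3$ and $m\le n$ be positive integers. Let $G$ be any $n$-vertex graph and let $M\subset V(G)$ be a set of $m$ vertices. If no copy of $K_r$ in $G$ intersects $M$, then $e(G)\le t_r(n,m)$, where \[ t_r(n,m):=\begin{cases} t_r(n) & \text{if } n\le (r-1)m,\\ \binom{n}{2}-nm+(r-1)\binom{m+1}{2} & \text{otherwise.}\end{cases} \] Moreover, if $n\le (r-1)m$ and $e(G)=t_r(n,m)$, then $G$ is isomorphic to $T_r(n)$.
   Context: $T_r(n)$ denotes the Turán graph, i.e. the complete balanced $(r-1)$-partite graph on $n$ vertices (part sizes as equal as possible), and $t_r(n)$ denotes its number of edges. $e(G)$ is the number of edges of $G$. -}

module Defs where

open import Data.Nat using (ℕ; zero; suc; _+_; _*_; _∸_; _≤_; _<_; _≤?_; _<?_)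
open import Data.Nat.DivMod using (_%_)
open import Data.Nat.Combinatorics using (_C_)
open import Data.Nat.Properties using (_≟_)
open import Data.Bool using (Bool; true; false; not; if_then_else_)
open import Data.Fin using (Fin; toℕ)
open import Data.Fin.Subset using (Subset; _∈_)
open import Data.List using (List; map; allFin)
open import Data.Nat.ListAction using (sum)
open import Data.Product using (Σ; _×_; ∃-syntax)
open import Relation.Nullary using (¬_; does; yes; no)
open import Relation.Binary.PropositionalEquality using (_≡_; refl; sym)

record Graph (n : ℕ) : Set where
  field
    adj   : Fin n → Fin n → Bool
    adj-sym   : ∀ i j → adj i j ≡ adj j i
    adj-irrefl : ∀ i → adj i i ≡ false
open Graph public

e : ∀ {n} → Graph n → ℕ
e {n} G = sum (map (λ i → sum (map (λ j →
            if does (toℕ i <? toℕ j) then (if adj G i j then 1 else 0) else 0)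
            (allFin n))) (allFin n))

record Copy-K (r : ℕ) {n : ℕ} (G : Graph n) : Set where
  field
    emb       : Fin r → Fin n
    emb-inj   : ∀ a b → emb a ≡ emb b → a ≡ b
    emb-adj   : ∀ a b → ¬ (a ≡ b) → adj G (emb a) (emb b) ≡ true
open Copy-K public

Intersects : ∀ {r n} {G : Graph n} → Copy-K r G → Subset n → Set
Intersects {r} K M = ∃[ a ] (emb K a ∈ M)

-- Turán graph T_r(n): complete balanced (r-1)-partite graph on Fin n,
-- vertex i lying in part (i mod (r-1)); parts then have sizes as equal as possible.
-- Given here with k+1 = r-1 parts, k = r ∸ 2.
part : ∀ {n} (k : ℕ) → Fin n → ℕ
part k i = toℕ i % suc k

eqb : ℕ → ℕ → Bool
eqb zero zero = true
eqb zero (suc _) = false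
eqb (suc _) zero = false
eqb (suc a) (suc b) = eqb a b

eqb-sym : (a b : ℕ) → eqb a b ≡ eqb b a
eqb-sym zero zero = refl
eqb-sym zero (suc _) = refl
eqb-sym (suc _) zero = refl
eqb-sym (suc a) (suc b) = eqb-sym a b

eqb-refl : (a : ℕ) → eqb a a ≡ true
eqb-refl zero = refl
eqb-refl (suc a) = eqb-refl a

neq-sym : (a b : ℕ) → not (eqb a b) ≡ not (eqb b a)
neq-sym a b rewrite eqb-sym a b = refl

neq-irrefl : (a : ℕ) → not (eqb a a) ≡ false
neq-irrefl a rewrite eqb-refl a = refl

turanAdj : ∀ {n} (k : ℕ) → Fin n → Fin n → Bool
turanAdj k i j = not (eqb (part k i) (part k j))

turanAdj-sym : ∀ {n} (k : ℕ) (i j : Fin n) → turanAdj k i j ≡ turanAdj k j i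
turanAdj-sym k i j = neq-sym (part k i) (part k j)

turanAdj-irrefl : ∀ {n} (k : ℕ) (i : Fin n) → turanAdj k i i ≡ false
turanAdj-irrefl k i = neq-irrefl (part k i)

T : (r n : ℕ) → Graph n
T r n = record { adj = turanAdj (r ∸ 2) ; adj-sym = turanAdj-sym (r ∸ 2)
               ; adj-irrefl = turanAdj-irrefl (r ∸ 2) }

t : (r n : ℕ) → ℕ
t r n = e (T r n)

-- t_r(n,m). The "otherwise" value C(n,2) - nm + (r-1)C(m+1,2) is computed as
-- (C(n,2) + (r-1)C(m+1,2)) ∸ nm, which is exact whenever the value is ≥ 0.
t₂ : (r n m : ℕ) → ℕ
t₂ r n m with n ≤? (r ∸ 1) * m
... | yes _ = t r n
... | no _  = (n C 2 + (r ∸ 1) * ((suc m) C 2)) ∸ n * m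

record _≅_ {n : ℕ} (G H : Graph n) : Set where
  field
    to      : Fin n → Fin n
    from    : Fin n → Fin n
    from-to : ∀ i → from (to i) ≡ i
    to-from : ∀ i → to (from i) ≡ i
    preserves : ∀ i j → adj H (to i) (to j) ≡ adj G i j

module Submission where

-- Write r = κ + 3,
-- K = r - 2, P = r - 1 (parts of T_r(n)), and use D(G) = 2e(G).  By
-- induction on n, simultaneously for every m = |M| (`EdgeBound.bound`):
--   * if n ≤ P m then D(G) ≤ D(T_r(n));
--   * if P m ≤ n then D(G) + 2nm ≤ 2 (C(n,2) + P C(m+1,2)).
-- The step deletes a suitable vertex u, as D(G) = D(G - u) + 2 deg(u).  If
-- none exists, all non-degrees are small and the greedy clique lemma
-- (`no-greedy-clique`) builds a K_r through M.  The degrees and closed-form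
-- degree sum of T_r(n) (`TuranGraph`) make both regimes agree at P m = n.
-- Uniqueness (`Uniqueness.unique`) reuses the deletion: G - u ≅ T_r(n-1) by
-- induction, the neighbourhood of u must miss exactly one part (else a K_r
-- meets M), and a part swap plus gluing u gives G ≅ T_r(n).

open import Defs
open import Data.Nat using (ℕ; _≤_; _*_; _∸_)
open import Data.Fin.Subset using (Subset; ∣_∣)
open import Data.Product using (_×_)
open import Relation.Nullary using (¬_)
open import Relation.Binary.PropositionalEquality using (_≡_)

open import Data.Nat using (zero; suc; _+_; _<_; z≤n; s≤s; s≤s⁻¹; _≤?_; _<?_)
import Data.Nat as ℕ
open import Data.Nat.Properties
open import Data.Nat.DivMod
open import Data.Nat.Tactic.RingSolver using (solve-∀)
open import Data.Nat.Combinatorics using (_C_; nCk+nC[k+1]≡[n+1]C[k+1]; nC1≡n)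
import Data.Nat.ListAction as ListAction
open import Data.Bool using (Bool; true; false; not; _∧_; if_then_else_)
import Data.Bool.Properties as Bool
open import Data.Fin using (Fin; zero; suc; toℕ; punchIn; punchOut; fromℕ; fromℕ<)
import Data.Fin as Fin
open import Data.Fin.Properties
  using (any?; all?; ¬∀⟶∃¬; punchInᵢ≢i; punchIn-punchOut; punchOut-punchIn; punchOut-cong;
         toℕ-injective; toℕ-fromℕ; toℕ-fromℕ<; toℕ<n)
open import Data.Fin.Permutation using (permutation)
open import Data.Vec using ([]; _∷_; lookup)
open import Data.Vec.Properties using (lookup⇒[]=)
import Data.List as List
import Data.List.Properties as List
open import Data.Product using (Σ; _,_; proj₁; proj₂)
open import Data.Sum using (_⊎_; inj₁; inj₂)
open import Data.Empty using (⊥; ⊥-elim)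
open import Relation.Nullary using (yes; no; does)
open import Relation.Nullary.Decidable using (dec-true; dec-false; _×-dec_)
open import Relation.Binary.PropositionalEquality
open import Relation.Binary.Definitions using (tri<; tri≈; tri>)
open import Algebra.Properties.CommutativeMonoid.Sum +-0-commutativeMonoid
  using (sum; sum-remove; sum-permute; sum-cong-≗; ∑-distrib-+; ∑-comm)

open _≅_

-- Finite sums over Fin n and counts of boolean predicates.

ind : Bool → ℕ
ind true = 1
ind false = 0

ind≤1 : ∀ b → ind b ≤ 1
ind≤1 true = s≤s z≤n
ind≤1 false = z≤n

ind-not : ∀ b → ind (not b) + ind b ≡ 1
ind-not true = refl
ind-not false = refl

if-ind : ∀ b → (if b then 1 else 0) ≡ ind b
if-ind true = refl
if-ind false = refl

ind-injective : ∀ a b → ind a ≡ ind b → a ≡ b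
ind-injective true true _ = refl
ind-injective false false _ = refl

-- ∑ f = f 0 + … + f (n-1).  It is kept abstract, so all reasoning about it
-- goes through the equations below (goals stay readable as sums).
abstract
  ∑ : ∀ {n} → (Fin n → ℕ) → ℕ
  ∑ = sum

  ∑-empty : ∀ (f : Fin zero → ℕ) → ∑ f ≡ 0
  ∑-empty f = refl

  ∑-suc : ∀ {n} (f : Fin (suc n) → ℕ) → ∑ f ≡ f zero + ∑ (λ i → f (suc i))
  ∑-suc f = refl

  ∑-cong : ∀ {n} {f g : Fin n → ℕ} → (∀ i → f i ≡ g i) → ∑ f ≡ ∑ g
  ∑-cong = sum-cong-≗

  ∑-+ : ∀ {n} (f g : Fin n → ℕ) → ∑ (λ i → f i + g i) ≡ ∑ f + ∑ g
  ∑-+ = ∑-distrib-+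

  ∑-swap : ∀ {m n} (f : Fin m → Fin n → ℕ) →
    ∑ (λ i → ∑ (λ j → f i j)) ≡ ∑ (λ j → ∑ (λ i → f i j))
  ∑-swap = ∑-comm

  ∑-remove : ∀ {n} (u : Fin (suc n)) (f : Fin (suc n) → ℕ) →
    ∑ f ≡ f u + ∑ (λ i → f (punchIn u i))
  ∑-remove u f = sum-remove {i = u} f

  ∑-perm : ∀ {n} (f : Fin n → ℕ) (to from : Fin n → Fin n) →
    (∀ i → from (to i) ≡ i) → (∀ i → to (from i) ≡ i) → ∑ (λ i → f (to i)) ≡ ∑ f
  ∑-perm f to from ft tf = sym (sum-permute f (permutation to from tf ft))

∑-mono : ∀ {n} {f g : Fin n → ℕ} → (∀ i → f i ≤ g i) → ∑ f ≤ ∑ g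
∑-mono {zero} {f} {g} h = ≤-reflexive (trans (∑-empty f) (sym (∑-empty g)))
∑-mono {suc n} {f} {g} h = begin
  ∑ f                          ≡⟨ ∑-suc f ⟩
  f zero + ∑ (λ i → f (suc i)) ≤⟨ +-mono-≤ (h zero) (∑-mono (λ i → h (suc i))) ⟩
  g zero + ∑ (λ i → g (suc i)) ≡⟨ ∑-suc g ⟨
  ∑ g                          ∎
  where open ≤-Reasoning

∑-const1 : ∀ {n} → ∑ {n} (λ _ → 1) ≡ n
∑-const1 {zero} = ∑-empty _
∑-const1 {suc n} = trans (∑-suc _) (cong suc (∑-const1 {n}))

∑-term : ∀ {n} (f : Fin n → ℕ) i → f i ≤ ∑ f
∑-term {suc n} f i = begin
  f i                               ≤⟨ m≤m+n (f i) _ ⟩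
  f i + ∑ (λ j → f (punchIn i j))   ≡⟨ ∑-remove i f ⟨
  ∑ f                               ∎
  where open ≤-Reasoning

∑-mono-tight : ∀ {n} {f g : Fin n → ℕ} → (∀ i → f i ≤ g i) → ∑ g ≤ ∑ f → ∀ i → f i ≡ g i
∑-mono-tight {suc n} {f} {g} h le i = ≤-antisym (h i) (+-cancelʳ-≤ (∑ rest-g) _ _ (begin
  g i + ∑ rest-g  ≡⟨ ∑-remove i g ⟨
  ∑ g             ≤⟨ le ⟩
  ∑ f             ≡⟨ ∑-remove i f ⟩
  f i + ∑ rest-f  ≤⟨ +-monoʳ-≤ (f i) (∑-mono (λ j → h (punchIn i j))) ⟩
  f i + ∑ rest-g  ∎))
  where
  open ≤-Reasoning
  rest-f rest-g : Fin n → ℕ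
  rest-f j = f (punchIn i j)
  rest-g j = g (punchIn i j)

cnt : ∀ {n} → (Fin n → Bool) → ℕ
cnt f = ∑ (λ i → ind (f i))

cnt≤ : ∀ {n} (f : Fin n → Bool) → cnt f ≤ n
cnt≤ {n} f = ≤-trans (∑-mono (λ i → ind≤1 (f i))) (≤-reflexive (∑-const1 {n}))

cnt-all : ∀ {n} → cnt {n} (λ _ → true) ≡ n
cnt-all {n} = ∑-const1 {n}

cnt-not : ∀ {n} (f : Fin n → Bool) → cnt (λ i → not (f i)) + cnt f ≡ n
cnt-not {n} f = begin
  cnt (λ i → not (f i)) + cnt f       ≡⟨ ∑-+ (λ i → ind (not (f i))) (λ i → ind (f i)) ⟨
  ∑ (λ i → ind (not (f i)) + ind (f i)) ≡⟨ ∑-cong (λ i → ind-not (f i)) ⟩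
  ∑ (λ _ → 1)                          ≡⟨ ∑-const1 {n} ⟩
  n                                    ∎
  where open ≡-Reasoning

cnt-remove : ∀ {n} (f : Fin (suc n) → Bool) u → cnt f ≡ ind (f u) + cnt (λ i → f (punchIn u i))
cnt-remove f u = ∑-remove u _

cnt≤1+cnt-remove : ∀ {n} (f : Fin (suc n) → Bool) u → cnt f ≤ suc (cnt (λ i → f (punchIn u i)))
cnt≤1+cnt-remove f u = ≤-trans (≤-reflexive (cnt-remove f u)) (+-monoˡ-≤ _ (ind≤1 (f u)))

cnt-remove-false : ∀ {n} (f : Fin (suc n) → Bool) u → f u ≡ false → cnt (λ i → f (punchIn u i)) ≡ cnt f
cnt-remove-false f u fu = sym (trans (cnt-remove f u) (cong (λ b → ind b + cnt (λ i → f (punchIn u i))) fu))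

cnt-remove-true : ∀ {n} (f : Fin (suc n) → Bool) u → f u ≡ true → suc (cnt (λ i → f (punchIn u i))) ≡ cnt f
cnt-remove-true f u fu = sym (trans (cnt-remove f u) (cong (λ b → ind b + cnt (λ i → f (punchIn u i))) fu))

cnt-witness : ∀ {n} (f : Fin n → Bool) → 0 < cnt f → Σ (Fin n) (λ i → f i ≡ true)
cnt-witness {n} f pos with any? (λ i → f i Bool.≟ true)
... | yes w = w
... | no none = ⊥-elim (<-irrefl refl (≤-trans pos (≤-reflexive (trans (∑-cong allFalse) (∑-zero {n})))))
  where
  allFalse : ∀ i → ind (f i) ≡ 0
  allFalse i with f i in fi
  ... | true = ⊥-elim (none (i , fi))
  ... | false = refl
  ∑-zero : ∀ {k} → ∑ {k} (λ _ → 0) ≡ 0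
  ∑-zero {zero} = ∑-empty _
  ∑-zero {suc k} = trans (∑-suc _) (∑-zero {k})

-- Degrees, the handshake identity and vertex deletion.

upperEdge : ∀ {n} → Graph n → Fin n → Fin n → ℕ
upperEdge G i j = if does (toℕ i <? toℕ j) then (if adj G i j then 1 else 0) else 0

listSum≡∑ : ∀ {n} (h : Fin n → ℕ) → ListAction.sum (List.map h (List.allFin n)) ≡ ∑ h
listSum≡∑ {n} h = trans (cong ListAction.sum (List.map-tabulate (λ i → i) h)) (go h)
  where
  go : ∀ {n} (h : Fin n → ℕ) → ListAction.sum (List.tabulate h) ≡ ∑ h
  go {zero} h = sym (∑-empty h)
  go {suc n} h = trans (cong (h zero +_) (go (λ i → h (suc i)))) (sym (∑-suc h))

e≡∑ : ∀ {n} (G : Graph n) → e G ≡ ∑ (λ i → ∑ (λ j → upperEdge G i j))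
e≡∑ G = trans (listSum≡∑ _) (∑-cong (λ i → listSum≡∑ _))

deg : ∀ {n} → Graph n → Fin n → ℕ
deg G x = cnt (λ y → adj G x y)

D : ∀ {n} → Graph n → ℕ
D G = ∑ (λ x → deg G x)

-- Non-degree: the number of vertices not adjacent to x (x itself included).
nd : ∀ {n} → Graph n → Fin n → ℕ
nd G x = cnt (λ y → not (adj G x y))

nd+deg : ∀ {n} (G : Graph n) x → nd G x + deg G x ≡ n
nd+deg G x = cnt-not (λ y → adj G x y)

nd≤ : ∀ {n} (G : Graph n) x c → n ≤ deg G x + c → nd G x ≤ c
nd≤ {n} G x c le = +-cancelʳ-≤ (deg G x) _ _ (begin
  nd G x + deg G x  ≡⟨ nd+deg G x ⟩
  n                 ≤⟨ le ⟩
  deg G x + c       ≡⟨ +-comm (deg G x) c ⟩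
  c + deg G x       ∎)
  where open ≤-Reasoning

ind-adj-self : ∀ {n} (G : Graph n) i → ind (adj G i i) ≡ 0
ind-adj-self G i rewrite adj-irrefl G i = refl

adj-split : ∀ {n} (G : Graph n) i j → ind (adj G i j) ≡ upperEdge G i j + upperEdge G j i
adj-split G i j with <-cmp (toℕ i) (toℕ j)
... | tri< i<j _ j≮i rewrite dec-true (toℕ i <? toℕ j) i<j | dec-false (toℕ j <? toℕ i) j≮i =
  trans (sym (if-ind (adj G i j))) (sym (+-identityʳ _))
... | tri≈ i≮j i≡j _ with toℕ-injective i≡j
... | refl rewrite dec-false (toℕ i <? toℕ i) i≮j = ind-adj-self G i
adj-split G i j | tri> i≮j _ j<i rewrite dec-false (toℕ i <? toℕ j) i≮j | dec-true (toℕ j <? toℕ i) j<i =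
  trans (cong ind (adj-sym G i j)) (sym (if-ind (adj G j i)))

D≡2e : ∀ {n} (G : Graph n) → D G ≡ e G + e G
D≡2e G = begin
  D G                                            ≡⟨ ∑-cong (λ i → ∑-cong (λ j → adj-split G i j)) ⟩
  ∑ (λ i → ∑ (λ j → U i j + U j i))              ≡⟨ ∑-cong (λ i → ∑-+ (U i) (λ j → U j i)) ⟩
  ∑ (λ i → ∑ (U i) + ∑ (λ j → U j i))            ≡⟨ ∑-+ (λ i → ∑ (U i)) (λ i → ∑ (λ j → U j i)) ⟩
  ∑ (λ i → ∑ (U i)) + ∑ (λ i → ∑ (λ j → U j i))  ≡⟨ cong (∑ (λ i → ∑ (U i)) +_) (∑-swap (λ j i → U i j)) ⟩
  ∑ (λ i → ∑ (U i)) + ∑ (λ i → ∑ (U i))          ≡⟨ cong₂ _+_ (e≡∑ G) (e≡∑ G) ⟨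
  e G + e G                                      ∎
  where
  open ≡-Reasoning
  U = upperEdge G

del : ∀ {n} → Graph (suc n) → Fin (suc n) → Graph n
del G u = record { adj = λ i j → adj G (punchIn u i) (punchIn u j)
                 ; adj-sym = λ i j → adj-sym G (punchIn u i) (punchIn u j)
                 ; adj-irrefl = λ i → adj-irrefl G (punchIn u i) }

deg-remove : ∀ {n} (G : Graph (suc n)) u → deg G u ≡ cnt (λ i → adj G u (punchIn u i))
deg-remove G u = trans (cnt-remove (adj G u) u) (cong (_+ cnt (λ i → adj G u (punchIn u i))) (ind-adj-self G u))

D-del : ∀ {n} (G : Graph (suc n)) u → D G ≡ D (del G u) + (deg G u + deg G u)
D-del G u = begin
  D G                                            ≡⟨ ∑-remove u _ ⟩
  deg G u + ∑ (λ i → deg G (pi i))               ≡⟨ cong (deg G u +_) (∑-cong (λ i → cnt-remove (adj G (pi i)) u)) ⟩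
  deg G u + ∑ (λ i → ind (adj G (pi i) u) + deg (del G u) i)
                                                 ≡⟨ cong (deg G u +_) (∑-+ (λ i → ind (adj G (pi i) u)) (deg (del G u))) ⟩
  deg G u + (∑ (λ i → ind (adj G (pi i) u)) + D (del G u))
                                                 ≡⟨ cong (λ z → deg G u + (z + D (del G u))) back ⟩
  deg G u + (deg G u + D (del G u))              ≡⟨ +-assoc (deg G u) _ _ ⟨
  (deg G u + deg G u) + D (del G u)              ≡⟨ +-comm (deg G u + deg G u) _ ⟩
  D (del G u) + (deg G u + deg G u)              ∎
  where
  open ≡-Reasoning
  pi = punchIn u
  back : ∑ (λ i → ind (adj G (pi i) u)) ≡ deg G u
  back = trans (∑-cong (λ i → cong ind (adj-sym G (pi i) u))) (sym (deg-remove G u))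

deg≤ : ∀ {n} (G : Graph (suc n)) u → deg G u ≤ n
deg≤ G u = ≤-trans (≤-reflexive (deg-remove G u)) (cnt≤ (λ i → adj G u (punchIn u i)))

vertex-split : ∀ {n} (u x : Fin (suc n)) → x ≡ u ⊎ Σ (Fin n) (λ i → x ≡ punchIn u i)
vertex-split u x with x Fin.≟ u
... | yes p = inj₁ p
... | no p = inj₂ (punchOut (λ q → p (sym q)) , sym (punchIn-punchOut _))

-- Cliques meeting M, and the greedy clique lemma.

Clique : ∀ {n} (G : Graph n) {j} → (Fin j → Fin n) → Set
Clique G {j} xs = (a b : Fin j) → ¬ (a ≡ b) → adj G (xs a) (xs b) ≡ true

Meets : ∀ {n} (mem : Fin n → Bool) {j} → (Fin j → Fin n) → Set
Meets mem {j} xs = Σ (Fin j) (λ a → mem (xs a) ≡ true)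

KFree : (s : ℕ) → ∀ {n} → Graph n → (Fin n → Bool) → Set
KFree s {n} G mem = (xs : Fin s → Fin n) → Clique G xs → Meets mem xs → ⊥

KFree-del : ∀ {s n} (G : Graph (suc n)) mem u → KFree s G mem →
  KFree s (del G u) (λ i → mem (punchIn u i))
KFree-del G mem u free xs cl meets = free (λ a → punchIn u (xs a)) cl meets

cons : ∀ {n j} → Fin n → (Fin j → Fin n) → Fin (suc j) → Fin n
cons y xs zero = y
cons y xs (suc a) = xs a

clique-cons : ∀ {n j} (G : Graph n) y (xs : Fin j → Fin n) → Clique G xs →
  (∀ a → adj G (xs a) y ≡ true) → Clique G (cons y xs)
clique-cons G y xs cl h zero zero ne = ⊥-elim (ne refl)
clique-cons G y xs cl h zero (suc b) ne = trans (adj-sym G y (xs b)) (h b)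
clique-cons G y xs cl h (suc a) zero ne = h a
clique-cons G y xs cl h (suc a) (suc b) ne = cl a b (λ q → ne (cong suc q))

ndIn : ∀ {n} → Graph n → (Fin n → Bool) → Fin n → ℕ
ndIn G S x = cnt (λ y → S y ∧ not (adj G x y))

ndIn≤nd : ∀ {n} (G : Graph n) S x → ndIn G S x ≤ nd G x
ndIn≤nd G S x = ∑-mono (λ y → ind-∧ (S y) (not (adj G x y)))
  where
  ind-∧ : ∀ a b → ind (a ∧ b) ≤ ind b
  ind-∧ true b = ≤-refl
  ind-∧ false b = z≤n

missIn : ∀ {n j} → Graph n → (Fin n → Bool) → (Fin j → Fin n) → ℕ
missIn G S xs = ∑ (λ a → ndIn G S (xs a))

miss : ∀ {n j} → Graph n → (Fin j → Fin n) → ℕ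
miss G xs = missIn G (λ _ → true) xs

missIn-single : ∀ {n} (G : Graph n) S v → missIn {j = 1} G S (λ _ → v) ≡ ndIn G S v
missIn-single G S v = trans (∑-suc _) (trans (cong (ndIn G S v +_) (∑-empty _)) (+-identityʳ _))

-- If the vertices xs miss fewer than |S| vertices of S in total, some vertex
-- of S is adjacent to all of them (each bad y ∈ S is missed by some x_a).
common-neighbour : ∀ {n j} (G : Graph n) (S : Fin n → Bool) (xs : Fin j → Fin n) →
  missIn G S xs < cnt S → Σ (Fin n) (λ y → S y ≡ true × ((a : Fin j) → adj G (xs a) y ≡ true))
common-neighbour {n} {j} G S xs lt
  with any? (λ y → (S y Bool.≟ true) ×-dec all? (λ a → adj G (xs a) y Bool.≟ true))
... | yes found = found
... | no none = ⊥-elim (<-irrefl refl (<-≤-trans lt counted))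
  where
  missed : ∀ y → ind (S y) ≤ ∑ (λ a → ind (S y ∧ not (adj G (xs a) y)))
  missed y with S y in Sy
  ... | false = z≤n
  ... | true with all? (λ a → adj G (xs a) y Bool.≟ true)
  ... | yes allAdj = ⊥-elim (none (y , Sy , allAdj))
  ... | no notAll with ¬∀⟶∃¬ j _ (λ a → adj G (xs a) y Bool.≟ true) notAll
  ... | (a , na) = ≤-trans (≤-reflexive (cong (λ b → ind (not b)) (sym (Bool.¬-not na))))
                           (∑-term (λ a → ind (not (adj G (xs a) y))) a)
  counted : cnt S ≤ missIn G S xs
  counted = ≤-trans (∑-mono missed)
                    (≤-reflexive (∑-swap (λ y a → ind (S y ∧ not (adj G (xs a) y)))))

budget-step : ∀ β s m c → suc s * β + m < c + β → m < c
budget-step β s m c h = +-cancelˡ-< β m c (begin-strict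
  β + m              ≤⟨ +-monoʳ-≤ β (m≤n+m m (s * β)) ⟩
  β + (s * β + m)    ≡⟨ +-assoc β (s * β) m ⟨
  suc s * β + m      <⟨ h ⟩
  c + β              ≡⟨ +-comm c β ⟩
  β + c              ∎)
  where open ≤-Reasoning

-- While the budget s β + missIn < |S| + β
-- holds, a common neighbour in S exists, so a clique on j vertices meeting M
-- grows to one on s + j vertices whose total non-degree rose by at most s β'.
greedy-extend : ∀ {n} (G : Graph n) (mem : Fin n → Bool) (S : Fin n → Bool) (β β' : ℕ) →
  (∀ y → S y ≡ true → ndIn G S y ≤ β) → (∀ y → S y ≡ true → nd G y ≤ β') →
  ∀ t s j → s + j ≡ t → (xs : Fin j → Fin n) → Clique G xs → Meets mem xs →
  s * β + missIn G S xs < cnt S + β →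
  Σ (Fin t → Fin n) (λ ys → Clique G ys × Meets mem ys × miss G ys ≤ miss G xs + s * β')
greedy-extend G mem S β β' hS hN t zero j refl xs cl meets budget =
  xs , cl , meets , ≤-reflexive (sym (+-identityʳ _))
greedy-extend G mem S β β' hS hN t (suc s) j size xs cl meets budget
  with common-neighbour G S xs (budget-step β s (missIn G S xs) (cnt S) budget)
... | (y , Sy , adjY)
  with greedy-extend G mem S β β' hS hN t s (suc j) (trans (+-suc s j) size) (cons y xs)
         (clique-cons G y xs cl adjY) (suc (proj₁ meets) , proj₂ meets) budget'
  where
  budget' : s * β + missIn G S (cons y xs) < cnt S + β
  budget' = ≤-<-trans (begin
    s * β + missIn G S (cons y xs)           ≡⟨ cong (s * β +_) (∑-suc _) ⟩
    s * β + (ndIn G S y + missIn G S xs)     ≤⟨ +-monoʳ-≤ (s * β) (+-monoˡ-≤ _ (hS y Sy)) ⟩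
    s * β + (β + missIn G S xs)              ≡⟨ +-assoc (s * β) β _ ⟨
    s * β + β + missIn G S xs                ≡⟨ cong (_+ missIn G S xs) (+-comm (s * β) β) ⟩
    suc s * β + missIn G S xs                ∎) budget
    where open ≤-Reasoning
... | (ys , cl' , meets' , le) = ys , cl' , meets' , ≤-trans le grow
  where
  grow : miss G (cons y xs) + s * β' ≤ miss G xs + suc s * β'
  grow = begin
    miss G (cons y xs) + s * β'          ≡⟨ cong (_+ s * β') (∑-suc _) ⟩
    nd G y + miss G xs + s * β'          ≤⟨ +-monoˡ-≤ (s * β') (+-monoˡ-≤ (miss G xs) (hN y Sy)) ⟩
    β' + miss G xs + s * β'              ≡⟨ cong (_+ s * β') (+-comm β' (miss G xs)) ⟩
    miss G xs + β' + s * β'              ≡⟨ +-assoc (miss G xs) β' (s * β') ⟩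
    miss G xs + suc s * β'               ∎
    where open ≤-Reasoning

-- Start from v ∈ M, take K vertices greedily
-- inside S and then one more common neighbour anywhere: this is a clique of
-- order K + 2 through M, unless one of the two budgets fails.
no-greedy-clique : ∀ {K n} (G : Graph n) (mem : Fin n → Bool) → KFree (suc (suc K)) G mem →
  (S : Fin n → Bool) (β β' : ℕ) →
  (∀ y → S y ≡ true → ndIn G S y ≤ β) → (∀ y → S y ≡ true → nd G y ≤ β') →
  (v : Fin n) → mem v ≡ true → K * β + ndIn G S v < cnt S + β → nd G v + K * β' < n → ⊥
no-greedy-clique {K} {n} G mem free S β β' hS hN v mv budgetS budget
  with greedy-extend G mem S β β' hS hN (suc K) K 1 (+-comm K 1) (λ _ → v) single (zero , mv)
         (subst (λ z → K * β + z < cnt S + β) (sym (missIn-single G S v)) budgetS)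
  where
  single : Clique G {1} (λ _ → v)
  single zero zero ne = ⊥-elim (ne refl)
... | (ys , cl , meets , le)
  with common-neighbour G (λ _ → true) ys
         (subst (miss G ys <_) (sym cnt-all)
           (≤-<-trans le (subst (λ z → z + K * β' < n) (sym (missIn-single G (λ _ → true) v)) budget)))
... | (y , _ , adjY) = free (cons y ys) (clique-cons G y ys cl adjY) (suc (proj₁ meets) , proj₂ meets)

ltb : ℕ → ℕ → Bool
ltb _ zero = false
ltb zero (suc _) = true
ltb (suc a) (suc b) = ltb a b

ltb-step : ∀ c s → ind (ltb c s) + ind (eqb c s) ≡ ind (ltb c (suc s))
ltb-step zero zero = refl
ltb-step zero (suc s) = refl
ltb-step (suc c) zero = refl
ltb-step (suc c) (suc s) = ltb-step c s

ltb-lt : ∀ c s → c < s → ltb c s ≡ true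
ltb-lt zero (suc s) _ = refl
ltb-lt (suc c) (suc s) (s≤s lt) = ltb-lt c s lt

ltb-refl : ∀ c → ltb c c ≡ false
ltb-refl zero = refl
ltb-refl (suc c) = ltb-refl c

eqb-true : ∀ a b → eqb a b ≡ true → a ≡ b
eqb-true zero zero _ = refl
eqb-true (suc a) (suc b) h = cong suc (eqb-true a b h)

eqb-false : ∀ a b → eqb a b ≡ false → ¬ a ≡ b
eqb-false zero zero () refl
eqb-false (suc a) (suc b) h refl = eqb-false a b h refl

eqb-≢ : ∀ a b → ¬ a ≡ b → eqb a b ≡ false
eqb-≢ zero zero ne = ⊥-elim (ne refl)
eqb-≢ zero (suc b) ne = refl
eqb-≢ (suc a) zero ne = refl
eqb-≢ (suc a) (suc b) ne = eqb-≢ a b (λ q → ne (cong suc q))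

eqb-inv : (f : ℕ → ℕ) → (∀ x → f (f x) ≡ x) → ∀ x y → eqb (f x) (f y) ≡ eqb x y
eqb-inv f inv x y with eqb x y in e
... | true rewrite eqb-true x y e = eqb-refl (f y)
... | false = eqb-≢ (f x) (f y) (λ q → eqb-false x y e (trans (sym (inv x)) (trans (cong f q) (inv y))))

-- c2 n = C(n,2), by the recursion that the edge counts below follow.
c2 : ℕ → ℕ
c2 zero = 0
c2 (suc n) = c2 n + n

nC2≡c2 : ∀ n → n C 2 ≡ c2 n
nC2≡c2 zero = refl
nC2≡c2 (suc n) = trans (sym (nCk+nC[k+1]≡[n+1]C[k+1] n 1))
                       (trans (cong₂ _+_ (nC1≡n n) (nC2≡c2 n)) (+-comm n (c2 n)))

punchIn-last : ∀ N (j : Fin N) → toℕ (punchIn (fromℕ N) j) ≡ toℕ j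
punchIn-last (suc N) zero = refl
punchIn-last (suc N) (suc j) = cong suc (punchIn-last N j)

step-same-part : ∀ X Y Z d q N → d + q ≡ N → X + 2 * (N * q) ≡ 2 * (Y + Z) →
  X + (d + d) + 2 * (suc N * q) ≡ 2 * (Y + N + Z)
step-same-part X Y Z d q .(d + q) refl ih =
  trans (i1 X d q) (trans (cong (_+ 2 * (d + q)) ih) (i2 Y Z d q))
  where
  i1 : ∀ X d q → X + (d + d) + 2 * (suc (d + q) * q) ≡ X + 2 * ((d + q) * q) + 2 * (d + q)
  i1 = solve-∀
  i2 : ∀ Y Z d q → 2 * (Y + Z) + 2 * (d + q) ≡ 2 * (Y + (d + q) + Z)
  i2 = solve-∀

step-new-round : ∀ X Y B P d q N → d + q ≡ N → P * suc q ≡ suc N →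
  X + 2 * (N * q) ≡ 2 * (Y + P * B) →
  X + (d + d) + 2 * (suc N * suc q) ≡ 2 * (Y + N + P * (B + suc q))
step-new-round X Y B P d q .(d + q) refl hP ih = begin
  X + (d + d) + 2 * (suc (d + q) * suc q)
    ≡⟨ i1 X d q ⟩
  X + 2 * ((d + q) * q) + (2 * (d + q) + 2 * suc (d + q))
    ≡⟨ cong (_+ (2 * (d + q) + 2 * suc (d + q))) ih ⟩
  2 * (Y + P * B) + (2 * (d + q) + 2 * suc (d + q))
    ≡⟨ i2 Y (P * B) d q ⟩
  2 * (Y + (d + q) + (P * B + suc (d + q)))
    ≡⟨ cong (λ z → 2 * (Y + (d + q) + (P * B + z))) hP ⟨
  2 * (Y + (d + q) + (P * B + P * suc q))
    ≡⟨ cong (λ z → 2 * (Y + (d + q) + z)) (*-distribˡ-+ P B (suc q)) ⟨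
  2 * (Y + (d + q) + P * (B + suc q)) ∎
  where
  open ≡-Reasoning
  i1 : ∀ X d q → X + (d + d) + 2 * (suc (d + q) * suc q)
                 ≡ X + 2 * ((d + q) * q) + (2 * (d + q) + 2 * suc (d + q))
  i1 = solve-∀
  i2 : ∀ Y Z d q → 2 * (Y + Z) + (2 * (d + q) + 2 * suc (d + q)) ≡ 2 * (Y + (d + q) + (Z + suc (d + q)))
  i2 = solve-∀

step-back-round : ∀ X Y B P m N → N ≡ P * suc m →
  X + 2 * (N * suc m) ≡ 2 * (Y + P * (B + suc m)) → X + 2 * (N * m) ≡ 2 * (Y + P * B)
step-back-round X Y B P m N hN ih = +-cancelʳ-≡ (2 * N) _ _ (begin
  X + 2 * (N * m) + 2 * N          ≡⟨ i1 X N m ⟩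
  X + 2 * (N * suc m)              ≡⟨ ih ⟩
  2 * (Y + P * (B + suc m))        ≡⟨ cong (λ z → 2 * (Y + z)) (*-distribˡ-+ P B (suc m)) ⟩
  2 * (Y + (P * B + P * suc m))    ≡⟨ i2 Y (P * B) (P * suc m) ⟩
  2 * (Y + P * B) + 2 * (P * suc m) ≡⟨ cong (λ z → 2 * (Y + P * B) + 2 * z) hN ⟨
  2 * (Y + P * B) + 2 * N          ∎)
  where
  open ≡-Reasoning
  i1 : ∀ X N m → X + 2 * (N * m) + 2 * N ≡ X + 2 * (N * suc m)
  i1 = solve-∀
  i2 : ∀ Y Z W → 2 * (Y + (Z + W)) ≡ 2 * (Y + Z) + 2 * W
  i2 = solve-∀

module TuranGraph (κ : ℕ) where
  K : ℕ
  K = suc κ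
  P : ℕ
  P = suc K

  TG : (N : ℕ) → Graph N
  TG N = T (suc P) N

  DT : ℕ → ℕ
  DT N = D (TG N)

  δ : ℕ → ℕ
  δ N = deg (TG (suc N)) (fromℕ N)

  del-last : ∀ N i j → adj (del (TG (suc N)) (fromℕ N)) i j ≡ adj (TG N) i j
  del-last N i j = cong₂ (λ a b → not (eqb (a % P) (b % P))) (punchIn-last N i) (punchIn-last N j)

  DT-suc : ∀ N → DT (suc N) ≡ DT N + (δ N + δ N)
  DT-suc N = trans (D-del (TG (suc N)) (fromℕ N))
                   (cong (_+ (δ N + δ N)) (∑-cong (λ i → ∑-cong (λ j → cong ind (del-last N i j)))))

  partSize : ℕ → ℕ → ℕ
  partSize c N = cnt (λ (j : Fin N) → eqb c (toℕ j % P))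

  -- Vertex N is adjacent exactly to the earlier vertices outside its own part.
  δ+partSize : ∀ N → δ N + partSize (N % P) N ≡ N
  δ+partSize N = trans (cong (_+ partSize (N % P) N) (trans (deg-remove (TG (suc N)) (fromℕ N))
                   (∑-cong (λ i → cong ind (cong₂ (λ a b → not (eqb (a % P) (b % P)))
                                                   (toℕ-fromℕ N) (punchIn-last N i))))))
                       (cnt-not (λ j → eqb (N % P) (toℕ j % P)))

  partSize-suc : ∀ c N → partSize c (suc N) ≡ partSize c N + ind (eqb c (N % P))
  partSize-suc c N = trans (cnt-remove (λ (j : Fin (suc N)) → eqb c (toℕ j % P)) (fromℕ N))
     (trans (cong₂ _+_ (cong (λ a → ind (eqb c (a % P))) (toℕ-fromℕ N))
                       (∑-cong (λ i → cong (λ a → ind (eqb c (a % P))) (punchIn-last N i))))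
            (+-comm (ind (eqb c (N % P))) (partSize c N)))

  %-unique : ∀ s q → s < P → (s + q * P) % P ≡ s
  %-unique s q lt = trans ([m+kn]%n≡m%n s q P) (m<n⇒m%n≡m lt)

  /-unique : ∀ s q → s < P → (s + q * P) / P ≡ q
  /-unique s q lt = trans (+-distrib-/ s (q * P) rem<) (cong₂ _+_ (m<n⇒m/n≡0 lt) (m*n/n≡m q P))
    where
    rem< : s % P + q * P % P < P
    rem< = subst (_< P) (sym (trans (cong₂ _+_ (m<n⇒m%n≡m lt) (m*n%n≡0 q P)) (+-identityʳ s))) lt

  div-mod : ∀ N → N ≡ N % P + (N / P) * P
  div-mod N = m≡m%n+[m/n]*n N P

  next-same : ∀ N → suc (N % P) < P → suc N / P ≡ N / P × suc N % P ≡ suc (N % P)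
  next-same N lt = trans (cong (_/ P) e1) (/-unique _ (N / P) lt) , trans (cong (_% P) e1) (%-unique _ (N / P) lt)
    where
    e1 : suc N ≡ suc (N % P) + (N / P) * P
    e1 = cong suc (div-mod N)

  next-round : ∀ N → suc (N % P) ≡ P → suc N ≡ 0 + suc (N / P) * P
  next-round N eq = trans (cong suc (div-mod N)) (cong (_+ (N / P) * P) eq)

  next-round-/ : ∀ N → suc (N % P) ≡ P → suc N / P ≡ suc (N / P)
  next-round-/ N eq = trans (cong (_/ P) (next-round N eq)) (/-unique 0 (suc (N / P)) (s≤s z≤n))

  next-round-% : ∀ N → suc (N % P) ≡ P → suc N % P ≡ 0
  next-round-% N eq = trans (cong (_% P) (next-round N eq)) (%-unique 0 (suc (N / P)) (s≤s z≤n))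

  partSize-formula : ∀ c → c < P → ∀ N → partSize c N ≡ N / P + ind (ltb c (N % P))
  partSize-formula c cP zero = ∑-empty _
  partSize-formula c cP (suc N) = begin
    partSize c (suc N)                                    ≡⟨ partSize-suc c N ⟩
    partSize c N + ind (eqb c (N % P))                    ≡⟨ cong (_+ ind (eqb c (N % P))) (partSize-formula c cP N) ⟩
    N / P + ind (ltb c (N % P)) + ind (eqb c (N % P))     ≡⟨ +-assoc (N / P) _ _ ⟩
    N / P + (ind (ltb c (N % P)) + ind (eqb c (N % P)))   ≡⟨ cong (N / P +_) (ltb-step c (N % P)) ⟩
    N / P + ind (ltb c (suc (N % P)))                     ≡⟨ next N (m≤n⇒m<n∨m≡n (m%n<n N P)) ⟩
    suc N / P + ind (ltb c (suc N % P))                   ∎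
    where
    open ≡-Reasoning
    next : ∀ N → suc (N % P) < P ⊎ suc (N % P) ≡ P →
      N / P + ind (ltb c (suc (N % P))) ≡ suc N / P + ind (ltb c (suc N % P))
    next N (inj₁ lt) = cong₂ (λ a b → a + ind (ltb c b)) (sym (proj₁ (next-same N lt))) (sym (proj₂ (next-same N lt)))
    next N (inj₂ eq) = begin
      N / P + ind (ltb c (suc (N % P)))   ≡⟨ cong (λ b → N / P + ind b) (ltb-lt c (suc (N % P)) (subst (c <_) (sym eq) cP)) ⟩
      N / P + 1                           ≡⟨ +-comm (N / P) 1 ⟩
      suc (N / P)                         ≡⟨ +-identityʳ _ ⟨
      suc (N / P) + ind (ltb c 0)         ≡⟨ cong₂ (λ a b → a + ind (ltb c b)) (sym (next-round-/ N eq)) (sym (next-round-% N eq)) ⟩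
      suc N / P + ind (ltb c (suc N % P)) ∎

  partSize-own : ∀ N → partSize (N % P) N ≡ N / P
  partSize-own N = trans (partSize-formula (N % P) (m%n<n N P) N)
                         (trans (cong (λ b → N / P + ind b) (ltb-refl (N % P))) (+-identityʳ _))

  δ+quot : ∀ N → δ N + N / P ≡ N
  δ+quot N = trans (cong (δ N +_) (sym (partSize-own N))) (δ+partSize N)

  partSize-min : ∀ c N → c < P → partSize c N ≤ partSize (N % P) N → N % P ≤ c × partSize c N ≡ N / P
  partSize-min c N cP le with c <? N % P
  ... | yes lt = ⊥-elim (<-irrefl refl (begin-strict
          N / P                 <⟨ n<1+n (N / P) ⟩
          suc (N / P)           ≡⟨ +-comm 1 (N / P) ⟩
          N / P + 1             ≡⟨ cong (λ b → N / P + ind b) (ltb-lt c (N % P) lt) ⟨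
          N / P + ind (ltb c (N % P)) ≡⟨ partSize-formula c cP N ⟨
          partSize c N          ≤⟨ le ⟩
          partSize (N % P) N    ≡⟨ partSize-own N ⟩
          N / P                 ∎))
    where open ≤-Reasoning
  ... | no nlt = ≮⇒≥ nlt , ≤-antisym (≤-trans le (≤-reflexive (partSize-own N)))
                                     (≤-trans (m≤m+n (N / P) _) (≤-reflexive (sym (partSize-formula c cP N))))

  P*quot≤ : ∀ N → P * (N / P) ≤ N
  P*quot≤ N = ≤-trans (≤-reflexive (*-comm P (N / P))) (m/n*n≤m N P)

  quot-range : ∀ N m → P * m ≤ N → N < P * m + P → N / P ≡ m
  quot-range N m le lt = trans (cong (_/ P) split) (/-unique (N ∸ P * m) m rem<)
    where
    split : N ≡ (N ∸ P * m) + m * P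
    split = sym (trans (cong ((N ∸ P * m) +_) (*-comm m P)) (m∸n+n≡m le))
    rem< : N ∸ P * m < P
    rem< = +-cancelʳ-≤ (P * m) _ _ (subst₂ (λ a b → suc a ≤ b) (sym (m∸n+n≡m le)) (+-comm (P * m) P) lt)

  DT-closed-quot : ∀ N → DT N + 2 * (N * (N / P)) ≡ 2 * (c2 N + P * c2 (suc (N / P)))
  DT-closed-quot zero rewrite ∑-empty (deg (TG zero)) | *-zeroʳ P = refl
  DT-closed-quot (suc N) with m≤n⇒m<n∨m≡n (m%n<n N P)
  ... | inj₁ lt = subst (λ q → DT (suc N) + 2 * (suc N * q) ≡ 2 * (c2 (suc N) + P * c2 (suc q)))
                        (sym (proj₁ (next-same N lt)))
                        (trans (cong (_+ 2 * (suc N * (N / P))) (DT-suc N))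
                               (step-same-part (DT N) (c2 N) (P * c2 (suc (N / P))) (δ N) (N / P) N
                                               (δ+quot N) (DT-closed-quot N)))
  ... | inj₂ eq = subst (λ q → DT (suc N) + 2 * (suc N * q) ≡ 2 * (c2 (suc N) + P * c2 (suc q)))
                        (sym (next-round-/ N eq))
                        (trans (cong (_+ 2 * (suc N * suc (N / P))) (DT-suc N))
                               (step-new-round (DT N) (c2 N) (c2 (suc (N / P))) P (δ N) (N / P) N
                                               (δ+quot N) (trans (*-comm P _) (sym (next-round N eq)))
                                               (DT-closed-quot N)))

  DT-closed : ∀ N m → P * m ≤ N → N ≤ P * m + P → DT N + 2 * (N * m) ≡ 2 * (c2 N + P * c2 (suc m))
  DT-closed N m le1 le2 with m≤n⇒m<n∨m≡n le2
  ... | inj₁ lt = subst (λ q → DT N + 2 * (N * q) ≡ 2 * (c2 N + P * c2 (suc q)))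
                        (quot-range N m le1 lt) (DT-closed-quot N)
  ... | inj₂ eq = step-back-round (DT N) (c2 N) (c2 (suc m)) P m N N≡
                    (subst (λ q → DT N + 2 * (N * q) ≡ 2 * (c2 N + P * c2 (suc q)))
                           (quot-range N (suc m) (≤-reflexive (sym N≡)) N<) (DT-closed-quot N))
    where
    N≡ : N ≡ P * suc m
    N≡ = trans eq (trans (+-comm (P * m) P) (sym (*-suc P m)))
    N< : N < P * suc m + P
    N< = subst (_< P * suc m + P) (sym N≡) (m<m+n (P * suc m) (s≤s z≤n))

-- Arithmetic for deleting a vertex in the regime P m ≤ n: the bound for
-- n + 1 follows from the bound for n when the deleted vertex has degree d.
outside-step-arith : ∀ A d m N X Y → A + 2 * (N * m) ≤ 2 * (X + Y) → d + m ≤ N →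
  (A + (d + d)) + 2 * (suc N * m) ≤ 2 * (X + N + Y)
outside-step-arith A d m N X Y ih dm = begin
  (A + (d + d)) + 2 * (suc N * m)   ≡⟨ i1 A d m N ⟩
  (A + 2 * (N * m)) + 2 * (d + m)   ≤⟨ +-mono-≤ ih (*-monoʳ-≤ 2 dm) ⟩
  2 * (X + Y) + 2 * N               ≡⟨ i2 X Y N ⟩
  2 * (X + N + Y)                   ∎
  where
  open ≤-Reasoning
  i1 : ∀ A d m N → (A + (d + d)) + 2 * (suc N * m) ≡ (A + 2 * (N * m)) + 2 * (d + m)
  i1 = solve-∀
  i2 : ∀ X Y N → 2 * (X + Y) + 2 * N ≡ 2 * (X + N + Y)
  i2 = solve-∀

inside-step-arith : ∀ A X B d N m K → A + 2 * (N * m) ≤ 2 * (X + suc K * B) → d ≤ K * suc m →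
  A + (d + d) + 2 * (suc N * suc m) ≤ 2 * (X + N + suc K * (B + suc m))
inside-step-arith A X B d N m K ih dm = begin
  A + (d + d) + 2 * (suc N * suc m)                     ≡⟨ i1 A d N m ⟩
  (A + 2 * (N * m)) + (2 * d + 2 * (N + suc m))         ≤⟨ +-mono-≤ ih (+-monoˡ-≤ (2 * (N + suc m)) (*-monoʳ-≤ 2 dm)) ⟩
  2 * (X + suc K * B) + (2 * (K * suc m) + 2 * (N + suc m)) ≡⟨ i2 X B N m K ⟩
  2 * (X + N + suc K * (B + suc m))                     ∎
  where
  open ≤-Reasoning
  i1 : ∀ A d N m → A + (d + d) + 2 * (suc N * suc m) ≡ (A + 2 * (N * m)) + (2 * d + 2 * (N + suc m))
  i1 = solve-∀
  i2 : ∀ X B N m K → 2 * (X + suc K * B) + (2 * (K * suc m) + 2 * (N + suc m))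
                     ≡ 2 * (X + N + suc K * (B + suc m))
  i2 = solve-∀

module EdgeBound (κ : ℕ) where
  open TuranGraph κ

  -- Both regimes at once, for every size m of M; this is the induction hypothesis.
  Bound : ℕ → Set
  Bound n = ∀ m (G : Graph n) (mem : Fin n → Bool) → cnt mem ≡ m → KFree (suc P) G mem →
    (n ≤ P * m → D G ≤ DT n) × (P * m ≤ n → D G + 2 * (n * m) ≤ 2 * (c2 n + P * c2 (suc m)))

  positive : ∀ {N} m → suc N ≤ P * m → 0 < m
  positive zero le with ≤-trans le (≤-reflexive (*-zeroʳ P))
  ... | ()
  positive (suc m) _ = s≤s z≤n

  -- In the Turán regime some vertex has degree at most δ N: otherwise every
  -- vertex misses at most ⌊N/P⌋ vertices, and the greedy lemma with S = V
  -- builds a K_r through a vertex of M.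
  low-degree-vertex : ∀ {N} m (G : Graph (suc N)) mem → cnt mem ≡ m → KFree (suc P) G mem →
    suc N ≤ P * m → Σ (Fin (suc N)) (λ u → deg G u ≤ δ N)
  low-degree-vertex {N} m G mem cm free le with any? (λ u → deg G u ≤? δ N)
  ... | yes found = found
  ... | no none = ⊥-elim (no-greedy-clique G mem free (λ _ → true) q q small small v mv budgetS budget)
    where
    q = N / P
    small : ∀ y → true ≡ true → nd G y ≤ q
    small y _ = nd≤ G y q (begin
      suc N           ≡⟨ cong suc (δ+quot N) ⟨
      suc (δ N) + q   ≤⟨ +-monoˡ-≤ q (≰⇒> (λ d → none (y , d))) ⟩
      deg G y + q     ∎)
      where open ≤-Reasoning
    witness = cnt-witness mem (subst (0 <_) (sym cm) (positive m le))
    v = proj₁ witness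
    mv = proj₂ witness
    budget : nd G v + K * q < suc N
    budget = s≤s (≤-trans (+-monoˡ-≤ (K * q) (small v refl)) (P*quot≤ N))
    budgetS : K * q + nd G v < cnt (λ (_ : Fin (suc N)) → true) + q
    budgetS = begin-strict
      K * q + nd G v  ≡⟨ +-comm (K * q) (nd G v) ⟩
      nd G v + K * q  <⟨ budget ⟩
      suc N           ≤⟨ m≤m+n (suc N) q ⟩
      suc N + q       ≡⟨ cong (_+ q) cnt-all ⟨
      cnt (λ _ → true) + q ∎
      where open ≤-Reasoning

  -- The Turán-regime bound for a graph on N vertices whose M-part has m
  -- vertices, given only suc N ≤ P (m + 1) (as after deleting a vertex).
  turan-ih : ∀ {N} → Bound N → ∀ (G : Graph N) mem m → cnt mem ≡ m → KFree (suc P) G mem →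
    suc N ≤ P * suc m → D G ≤ DT N
  turan-ih {N} ih G mem m cm free le with N ≤? P * m
  ... | yes N≤ = proj₁ (ih m G mem cm free) N≤
  ... | no N≰ = +-cancelʳ-≤ (2 * (N * m)) _ _ (begin
      D G + 2 * (N * m)                 ≤⟨ proj₂ (ih m G mem cm free) Pm≤ ⟩
      2 * (c2 N + P * c2 (suc m))       ≡⟨ DT-closed N m Pm≤ N≤ ⟨
      DT N + 2 * (N * m)                ∎)
    where
    open ≤-Reasoning
    Pm≤ : P * m ≤ N
    Pm≤ = <⇒≤ (≰⇒> N≰)
    N≤ : N ≤ P * m + P
    N≤ = ≤-trans (n≤1+n N) (≤-trans le (≤-reflexive (trans (*-suc P m) (+-comm P (P * m)))))

  delete-turan : ∀ {N} → Bound N → ∀ m (G : Graph (suc N)) mem → cnt mem ≡ m → KFree (suc P) G mem →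
    suc N ≤ P * m → ∀ u → D (del G u) ≤ DT N
  delete-turan ih m G mem cm free le u =
    turan-ih ih (del G u) (λ i → mem (punchIn u i)) _ refl (KFree-del G mem u free)
             (≤-trans le (*-monoʳ-≤ P (≤-trans (≤-reflexive (sym cm)) (cnt≤1+cnt-remove mem u))))

  turan-step : ∀ {N} → Bound N → ∀ m (G : Graph (suc N)) mem → cnt mem ≡ m → KFree (suc P) G mem →
    suc N ≤ P * m → D G ≤ DT (suc N)
  turan-step {N} ih m G mem cm free le with low-degree-vertex m G mem cm free le
  ... | (u , du) = begin
    D G                                ≡⟨ D-del G u ⟩
    D (del G u) + (deg G u + deg G u)  ≤⟨ +-mono-≤ (delete-turan ih m G mem cm free le u) (+-mono-≤ du du) ⟩
    DT N + (δ N + δ N)                 ≡⟨ DT-suc N ⟨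
    DT (suc N)                         ∎
    where open ≤-Reasoning

  delete-outside : ∀ {N} → Bound N → ∀ m (G : Graph (suc N)) mem → cnt mem ≡ m → KFree (suc P) G mem →
    P * m ≤ N → ∀ u → mem u ≡ false → deg G u + m ≤ N →
    D G + 2 * (suc N * m) ≤ 2 * (c2 (suc N) + P * c2 (suc m))
  delete-outside {N} ih m G mem cm free Pm≤ u mu du = begin
    D G + 2 * (suc N * m)                                ≡⟨ cong (_+ 2 * (suc N * m)) (D-del G u) ⟩
    D (del G u) + (deg G u + deg G u) + 2 * (suc N * m)  ≤⟨ outside-step-arith (D (del G u)) (deg G u) m N (c2 N) (P * c2 (suc m)) ih' du ⟩
    2 * (c2 N + N + P * c2 (suc m))                      ∎
    where
    open ≤-Reasoning
    ih' = proj₂ (ih m (del G u) (λ i → mem (punchIn u i)) (trans (cnt-remove-false mem u mu) cm)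
                   (KFree-del G mem u free)) Pm≤

  delete-inside : ∀ {N} → Bound N → ∀ m (G : Graph (suc N)) mem → cnt mem ≡ m → KFree (suc P) G mem →
    P * m ≤ N → ∀ v → mem v ≡ true → deg G v ≤ K * m →
    D G + 2 * (suc N * m) ≤ 2 * (c2 (suc N) + P * c2 (suc m))
  delete-inside {N} ih m G mem cm free Pm≤ v mv dv =
    subst (λ z → D G + 2 * (suc N * z) ≤ 2 * (c2 (suc N) + P * c2 (suc z))) m'+1≡m (begin
      D G + 2 * (suc N * suc m')                                ≡⟨ cong (_+ 2 * (suc N * suc m')) (D-del G v) ⟩
      D (del G v) + (deg G v + deg G v) + 2 * (suc N * suc m')  ≤⟨ inside-step-arith (D (del G v)) (c2 N) (c2 (suc m')) (deg G v) N m' K ih' dv' ⟩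
      2 * (c2 N + N + P * (c2 (suc m') + suc m'))               ∎)
    where
    open ≤-Reasoning
    m' = cnt (λ i → mem (punchIn v i))
    m'+1≡m : suc m' ≡ m
    m'+1≡m = trans (cnt-remove-true mem v mv) cm
    dv' : deg G v ≤ K * suc m'
    dv' = subst (λ z → deg G v ≤ K * z) (sym m'+1≡m) dv
    ih' = proj₂ (ih m' (del G v) (λ i → mem (punchIn v i)) refl (KFree-del G mem v free))
                (≤-trans (*-monoʳ-≤ P (≤-trans (n≤1+n m') (≤-reflexive m'+1≡m))) Pm≤)

  -- Then the greedy lemma
  -- with S = V ∖ M (each of whose vertices misses at most m vertices) gives
  -- a K_r through M.
  no-low-vertex : ∀ {N} m (G : Graph (suc N)) mem → cnt mem ≡ m → KFree (suc P) G mem → P * m ≤ N →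
    (∀ u → mem u ≡ false → N < deg G u + m) → (∀ v → mem v ≡ true → K * m < deg G v) → ⊥
  no-low-vertex {N} m G mem cm free Pm≤ outHigh inHigh =
    no-greedy-clique G mem free S m m smallS small v mv budgetS budget
    where
    S : Fin (suc N) → Bool
    S u = not (mem u)
    small : ∀ y → S y ≡ true → nd G y ≤ m
    small y Sy = nd≤ G y m (outHigh y (trans (sym (Bool.not-involutive (mem y))) (cong not Sy)))
    smallS : ∀ y → S y ≡ true → ndIn G S y ≤ m
    smallS y Sy = ≤-trans (ndIn≤nd G S y) (small y Sy)
    m>0 : 0 < m
    m>0 with mem zero in m0
    ... | true = subst (0 <_) cm (≤-trans (≤-reflexive (cong ind (sym m0))) (∑-term (λ i → ind (mem i)) zero))
    ... | false = +-cancelˡ-< N 0 m (subst (_≤ N + m) (cong suc (sym (+-identityʳ N)))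
                    (≤-trans (outHigh zero m0) (+-monoˡ-≤ m (deg≤ G zero))))
    witness = cnt-witness mem (subst (0 <_) (sym cm) m>0)
    v = proj₁ witness
    mv = proj₂ witness
    budget : nd G v + K * m < suc N
    budget = begin-strict
      nd G v + K * m        <⟨ +-monoʳ-< (nd G v) (inHigh v mv) ⟩
      nd G v + deg G v      ≡⟨ nd+deg G v ⟩
      suc N                 ∎
      where open ≤-Reasoning
    budgetS : K * m + ndIn G S v < cnt S + m
    budgetS = begin-strict
      K * m + ndIn G S v    ≤⟨ +-monoʳ-≤ (K * m) (ndIn≤nd G S v) ⟩
      K * m + nd G v        ≡⟨ +-comm (K * m) (nd G v) ⟩
      nd G v + K * m        <⟨ budget ⟩
      suc N                 ≡⟨ trans (cong (cnt S +_) (sym cm)) (cnt-not mem) ⟨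
      cnt S + m             ∎
      where open ≤-Reasoning

  sparse-step-proper : ∀ {N} → Bound N → ∀ m (G : Graph (suc N)) mem → cnt mem ≡ m → KFree (suc P) G mem →
    P * m ≤ N → D G + 2 * (suc N * m) ≤ 2 * (c2 (suc N) + P * c2 (suc m))
  sparse-step-proper {N} ih m G mem cm free Pm≤
    with any? (λ u → (mem u Bool.≟ false) ×-dec (deg G u + m ≤? N))
  ... | yes (u , mu , du) = delete-outside ih m G mem cm free Pm≤ u mu du
  ... | no noOut with any? (λ v → (mem v Bool.≟ true) ×-dec (deg G v ≤? K * m))
  ... | yes (v , mv , dv) = delete-inside ih m G mem cm free Pm≤ v mv dv
  ... | no noIn = ⊥-elim (no-low-vertex m G mem cm free Pm≤
                            (λ u mu → ≰⇒> (λ d → noOut (u , mu , d)))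
                            (λ v mv → ≰⇒> (λ d → noIn (v , mv , d))))

  -- Regime P m ≤ N + 1; at N + 1 = P m both regimes agree by the closed form.
  sparse-step : ∀ {N} → Bound N → ∀ m (G : Graph (suc N)) mem → cnt mem ≡ m → KFree (suc P) G mem →
    P * m ≤ suc N → D G + 2 * (suc N * m) ≤ 2 * (c2 (suc N) + P * c2 (suc m))
  sparse-step {N} ih m G mem cm free le with suc N ≤? P * m
  ... | yes tur = begin
    D G + 2 * (suc N * m)                  ≤⟨ +-monoˡ-≤ (2 * (suc N * m)) (turan-step ih m G mem cm free tur) ⟩
    DT (suc N) + 2 * (suc N * m)           ≡⟨ DT-closed (suc N) m le (≤-trans tur (m≤m+n (P * m) P)) ⟩
    2 * (c2 (suc N) + P * c2 (suc m))      ∎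
    where open ≤-Reasoning
  ... | no tur = sparse-step-proper ih m G mem cm free (s≤s⁻¹ (≰⇒> tur))

  bound : ∀ n → Bound n
  bound zero m G mem cm free = (λ _ → ≤-trans (≤-reflexive (∑-empty (deg G))) z≤n)
                             , (λ _ → ≤-trans (≤-reflexive (cong (_+ 0) (∑-empty (deg G)))) z≤n)
  bound (suc N) m G mem cm free = turan-step (bound N) m G mem cm free , sparse-step (bound N) m G mem cm free

iso-trans : ∀ {n} {G H I : Graph n} → G ≅ H → H ≅ I → G ≅ I
iso-trans σ ρ = record
  { to = λ i → to ρ (to σ i)
  ; from = λ i → from σ (from ρ i)
  ; from-to = λ i → trans (cong (from σ) (from-to ρ (to σ i))) (from-to σ i)
  ; to-from = λ i → trans (cong (to ρ) (to-from σ (from ρ i))) (to-from ρ i)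
  ; preserves = λ i j → trans (preserves ρ (to σ i) (to σ j)) (preserves σ i j) }

iso-same-adj : ∀ {n} {G H : Graph n} → (∀ i j → adj H i j ≡ adj G i j) → G ≅ H
iso-same-adj h = record { to = λ i → i ; from = λ i → i ; from-to = λ _ → refl ; to-from = λ _ → refl
                        ; preserves = h }

module Glue {N : ℕ} (G H : Graph (suc N)) (u w : Fin (suc N)) (σ : del G u ≅ del H w)
  (matches : ∀ i → adj G u (punchIn u i) ≡ adj H w (punchIn w (to σ i))) where

  toG : Fin (suc N) → Fin (suc N)
  toG x with x Fin.≟ u
  ... | yes _ = w
  ... | no p = punchIn w (to σ (punchOut (λ q → p (sym q))))

  fromG : Fin (suc N) → Fin (suc N)
  fromG y with y Fin.≟ w
  ... | yes _ = u
  ... | no p = punchIn u (from σ (punchOut (λ q → p (sym q))))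

  toG-u : toG u ≡ w
  toG-u with u Fin.≟ u
  ... | yes _ = refl
  ... | no p = ⊥-elim (p refl)

  toG-punchIn : ∀ i → toG (punchIn u i) ≡ punchIn w (to σ i)
  toG-punchIn i with punchIn u i Fin.≟ u
  ... | yes q = ⊥-elim (punchInᵢ≢i u i q)
  ... | no p = cong (λ z → punchIn w (to σ z)) (trans (punchOut-cong u refl) (punchOut-punchIn u))

  fromG-w : fromG w ≡ u
  fromG-w with w Fin.≟ w
  ... | yes _ = refl
  ... | no p = ⊥-elim (p refl)

  fromG-punchIn : ∀ i → fromG (punchIn w i) ≡ punchIn u (from σ i)
  fromG-punchIn i with punchIn w i Fin.≟ w
  ... | yes q = ⊥-elim (punchInᵢ≢i w i q)
  ... | no p = cong (λ z → punchIn u (from σ z)) (trans (punchOut-cong w refl) (punchOut-punchIn w))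

  from-toG : ∀ x → fromG (toG x) ≡ x
  from-toG x with vertex-split u x
  ... | inj₁ refl = trans (cong fromG toG-u) fromG-w
  ... | inj₂ (i , refl) = trans (cong fromG (toG-punchIn i))
                                (trans (fromG-punchIn (to σ i)) (cong (punchIn u) (from-to σ i)))

  to-fromG : ∀ y → toG (fromG y) ≡ y
  to-fromG y with vertex-split w y
  ... | inj₁ refl = trans (cong toG fromG-w) toG-u
  ... | inj₂ (i , refl) = trans (cong toG (fromG-punchIn i))
                                (trans (toG-punchIn (from σ i)) (cong (punchIn w) (to-from σ i)))

  preservesG : ∀ x y → adj H (toG x) (toG y) ≡ adj G x y
  preservesG x y with vertex-split u x | vertex-split u y
  ... | inj₁ refl | inj₁ refl =
    trans (cong₂ (adj H) toG-u toG-u) (trans (adj-irrefl H w) (sym (adj-irrefl G u)))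
  ... | inj₁ refl | inj₂ (j , refl) = trans (cong₂ (adj H) toG-u (toG-punchIn j)) (sym (matches j))
  ... | inj₂ (i , refl) | inj₁ refl = trans (cong₂ (adj H) (toG-punchIn i) toG-u)
      (trans (adj-sym H _ w) (trans (sym (matches i)) (adj-sym G u _)))
  ... | inj₂ (i , refl) | inj₂ (j , refl) = trans (cong₂ (adj H) (toG-punchIn i) (toG-punchIn j)) (preserves σ i j)

  iso : G ≅ H
  iso = record { to = toG ; from = fromG ; from-to = from-toG ; to-from = to-fromG ; preserves = preservesG }

-- Exchanging part c of T_r(N) with the part s = N % P of the next vertex:
-- vertex q P + c ↔ q P + s.  When N % P ≤ c this stays inside Fin N, and it
-- is an automorphism of T_r(N) since it permutes the parts.
module PartSwap (κ : ℕ) (N c : ℕ) (cP : c < TuranGraph.P κ) (sc : N % TuranGraph.P κ ≤ c) where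
  open TuranGraph κ

  s : ℕ
  s = N % P

  sw : ℕ → ℕ
  sw x with eqb x c | eqb x s
  ... | true | _ = s
  ... | false | true = c
  ... | false | false = x

  sw-c : sw c ≡ s
  sw-c with eqb c c in e
  ... | true = refl
  ... | false = ⊥-elim (eqb-false c c e refl)

  sw-at-c : ∀ x → x ≡ c → sw x ≡ s
  sw-at-c x refl = sw-c

  sw-s : ∀ x → ¬ x ≡ c → x ≡ s → sw x ≡ c
  sw-s x ne eq with eqb x c in e1 | eqb x s in e2
  ... | true | _ = ⊥-elim (ne (eqb-true x c e1))
  ... | false | true = refl
  ... | false | false = ⊥-elim (eqb-false x s e2 eq)

  sw-other : ∀ x → ¬ x ≡ c → ¬ x ≡ s → sw x ≡ x
  sw-other x n1 n2 with eqb x c in e1 | eqb x s in e2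
  ... | true | _ = ⊥-elim (n1 (eqb-true x c e1))
  ... | false | true = ⊥-elim (n2 (eqb-true x s e2))
  ... | false | false = refl

  sw-lt : ∀ x → x < P → sw x < P
  sw-lt x xP with eqb x c | eqb x s
  ... | true | _ = m%n<n N P
  ... | false | true = cP
  ... | false | false = xP

  sw-inv : ∀ x → sw (sw x) ≡ x
  sw-inv x with x ℕ.≟ c | x ℕ.≟ s
  ... | yes p | _ with s ℕ.≟ c
  ...   | yes q = trans (cong sw (sw-at-c x p)) (trans (sw-at-c s q) (trans q (sym p)))
  ...   | no q = trans (cong sw (sw-at-c x p)) (trans (sw-s s q refl) (sym p))
  sw-inv x | no p | yes q = trans (cong sw (sw-s x p q)) (trans sw-c (sym q))
  sw-inv x | no p | no q = trans (cong sw (sw-other x p q)) (sw-other x p q)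

  τn : ℕ → ℕ
  τn x = sw (x % P) + (x / P) * P

  τn% : ∀ x → τn x % P ≡ sw (x % P)
  τn% x = %-unique (sw (x % P)) (x / P) (sw-lt (x % P) (m%n<n x P))

  τn-inv : ∀ x → τn (τn x) ≡ x
  τn-inv x = trans (cong₂ (λ a b → sw a + b * P) (τn% x) (/-unique (sw (x % P)) (x / P) (sw-lt (x % P) (m%n<n x P))))
                   (trans (cong (_+ (x / P) * P) (sw-inv (x % P))) (sym (div-mod x)))

  τn-lt : ∀ x → x < N → τn x < N
  τn-lt x xN with eqb (x % P) c in e1 | eqb (x % P) s in e2
  ... | true | _ = ≤-trans (s≤s (+-monoˡ-≤ ((x / P) * P) (≤-trans sc (≤-reflexive (sym (eqb-true (x % P) c e1))))))
                           (≤-trans (≤-reflexive (cong suc (sym (div-mod x)))) xN)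
  ... | false | true = ≤-trans (≤-trans (+-monoˡ-≤ ((x / P) * P) cP) (*-monoˡ-≤ P q<)) (m/n*n≤m N P)
    where
    x≡ : x ≡ s + (x / P) * P
    x≡ = trans (div-mod x) (cong (_+ (x / P) * P) (eqb-true (x % P) s e2))
    q< : suc (x / P) ≤ N / P
    q< = *-cancelʳ-< P (x / P) (N / P)
           (+-cancelˡ-< s _ _ (≤-trans (≤-reflexive (cong suc (sym x≡))) (≤-trans xN (≤-reflexive (div-mod N)))))
  ... | false | false = subst (_< N) (div-mod x) xN

  τ : Fin N → Fin N
  τ j = fromℕ< (τn-lt (toℕ j) (toℕ<n j))

  toℕ-τ : ∀ j → toℕ (τ j) ≡ τn (toℕ j)
  toℕ-τ j = toℕ-fromℕ< _

  τ-part : ∀ j → toℕ (τ j) % P ≡ sw (toℕ j % P)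
  τ-part j = trans (cong (_% P) (toℕ-τ j)) (τn% (toℕ j))

  τ-inv : ∀ j → τ (τ j) ≡ j
  τ-inv j = toℕ-injective (trans (toℕ-τ (τ j)) (trans (cong τn (toℕ-τ j)) (τn-inv (toℕ j))))

  τ-auto : TG N ≅ TG N
  τ-auto = record { to = τ ; from = τ ; from-to = τ-inv ; to-from = τ-inv
                  ; preserves = λ i j → cong not (trans (cong₂ eqb (τ-part i) (τ-part j))
                                                        (eqb-inv sw sw-inv (toℕ i % P) (toℕ j % P))) }

-- A vertex v ∈ M is itself a non-neighbour of v inside M, so its
-- non-degree outside M is strictly smaller than its non-degree.
ndIn-outside<nd : ∀ {n} (G : Graph n) (mem : Fin n → Bool) v → mem v ≡ true →
  suc (ndIn G (λ y → not (mem y)) v) ≤ nd G v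
ndIn-outside<nd G mem v mv = begin
  suc (cnt (λ y → not (mem y) ∧ not (adj G v y)))
    ≡⟨ +-comm 1 _ ⟩
  cnt (λ y → not (mem y) ∧ not (adj G v y)) + 1
    ≤⟨ +-monoʳ-≤ _ (≤-trans (≤-reflexive (cong₂ (λ a b → ind (a ∧ not b)) (sym mv) (sym (adj-irrefl G v))))
                            (∑-term (λ y → ind (mem y ∧ not (adj G v y))) v)) ⟩
  cnt (λ y → not (mem y) ∧ not (adj G v y)) + cnt (λ y → mem y ∧ not (adj G v y))
    ≡⟨ ∑-+ (λ y → ind (not (mem y) ∧ not (adj G v y))) (λ y → ind (mem y ∧ not (adj G v y))) ⟨
  ∑ (λ y → ind (not (mem y) ∧ not (adj G v y)) + ind (mem y ∧ not (adj G v y)))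
    ≡⟨ ∑-cong (λ y → ind-split (mem y) (not (adj G v y))) ⟩
  nd G v ∎
  where
  open ≤-Reasoning
  ind-split : ∀ a b → ind (not a ∧ b) + ind (a ∧ b) ≡ ind b
  ind-split true b = refl
  ind-split false b = +-identityʳ (ind b)

halve : ∀ x y → x + x ≤ y + y → x ≤ y
halve x y h with x ≤? y
... | yes x≤y = x≤y
... | no x≰y = ⊥-elim (<-irrefl refl (≤-<-trans h (+-mono-< (≰⇒> x≰y) (≰⇒> x≰y))))

split-eq : ∀ a b c d → a + b ≡ c + d → a ≤ c → b ≤ d → a ≡ c × b ≡ d
split-eq a b c d eq a≤c b≤d = a≡c , +-cancelˡ-≡ c b d (trans (cong (_+ b) (sym a≡c)) eq)
  where
  a≡c : a ≡ c
  a≡c = ≤-antisym a≤c (+-cancelʳ-≤ d _ _ (≤-trans (≤-reflexive (sym eq)) (+-monoʳ-≤ a b≤d)))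

-- Uniqueness of the extremal graph in the Turán regime.
module Uniqueness (κ : ℕ) where
  open TuranGraph κ
  open EdgeBound κ

  -- In an extremal graph every vertex has degree at least δ N, since
  -- deleting it leaves at most D(T_r(N)).
  extremal-min-degree : ∀ {N} m (G : Graph (suc N)) mem → cnt mem ≡ m → KFree (suc P) G mem →
    suc N ≤ P * m → D G ≡ DT (suc N) → ∀ v → δ N ≤ deg G v
  extremal-min-degree {N} m G mem cm free le eqD v = halve (δ N) (deg G v) (+-cancelˡ-≤ (DT N) _ _ (begin
    DT N + (δ N + δ N)                 ≡⟨ DT-suc N ⟨
    DT (suc N)                         ≡⟨ eqD ⟨
    D G                                ≡⟨ D-del G v ⟩
    D (del G v) + (deg G v + deg G v)  ≤⟨ +-monoˡ-≤ _ (delete-turan (bound N) m G mem cm free le v) ⟩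
    DT N + (deg G v + deg G v)         ∎))
    where open ≤-Reasoning

  -- An extremal graph with P m' < N < P (m' + 1) and |M| = m' + 1 cannot have
  -- every vertex outside M of degree > δ N: the greedy lemma with S = V ∖ M
  -- (β = m' = ⌊N/P⌋) would give a K_r through M.
  crowded-M : ∀ {N} m' (G : Graph (suc N)) mem → cnt mem ≡ suc m' → KFree (suc P) G mem →
    suc N ≤ P * suc m' → ¬ (N ≤ P * m') →
    (∀ u → mem u ≡ false → δ N < deg G u) → (∀ v → δ N ≤ deg G v) → ⊥
  crowded-M {N} m' G mem cm free le N≰ outHigh allHigh =
    no-greedy-clique G mem free S m' m' smallS small v mv budgetS budget
    where
    Pm'<N : P * m' < N
    Pm'<N = ≰⇒> N≰
    δ+m' : δ N + m' ≡ N
    δ+m' = trans (cong (δ N +_) (sym (quot-range N m' (<⇒≤ Pm'<N)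
                   (≤-trans le (≤-reflexive (trans (*-suc P m') (+-comm P (P * m')))))))) (δ+quot N)
    S : Fin (suc N) → Bool
    S u = not (mem u)
    small : ∀ y → S y ≡ true → nd G y ≤ m'
    small y Sy = nd≤ G y m' (≤-trans (≤-reflexive (cong suc (sym δ+m')))
                   (+-monoˡ-≤ m' (outHigh y (trans (sym (Bool.not-involutive (mem y))) (cong not Sy)))))
    smallS : ∀ y → S y ≡ true → ndIn G S y ≤ m'
    smallS y Sy = ≤-trans (ndIn≤nd G S y) (small y Sy)
    witness = cnt-witness mem (subst (0 <_) (sym cm) (s≤s z≤n))
    v = proj₁ witness
    mv = proj₂ witness
    ndv : nd G v ≤ suc m'
    ndv = nd≤ G v (suc m') (≤-trans (≤-reflexive (cong suc (sym δ+m')))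
                            (≤-trans (≤-reflexive (sym (+-suc (δ N) m'))) (+-monoˡ-≤ (suc m') (allHigh v))))
    budget : nd G v + K * m' < suc N
    budget = s≤s (≤-trans (+-monoˡ-≤ (K * m') ndv) Pm'<N)
    budgetS : K * m' + ndIn G S v < cnt S + m'
    budgetS = begin-strict
      K * m' + ndIn G S v   ≤⟨ +-monoʳ-≤ (K * m') (s≤s⁻¹ (≤-trans (ndIn-outside<nd G mem v mv) ndv)) ⟩
      K * m' + m'           ≡⟨ +-comm (K * m') m' ⟩
      P * m'                <⟨ Pm'<N ⟩
      N                     ≡⟨ suc-injective (trans (sym (+-suc (cnt S) m')) (trans (cong (cnt S +_) (sym cm)) (cnt-not mem))) ⟨
      cnt S + m'            ∎
      where open ≤-Reasoning

  deletable-vertex : ∀ {N} m (G : Graph (suc N)) mem → cnt mem ≡ m → KFree (suc P) G mem →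
    suc N ≤ P * m → D G ≡ DT (suc N) →
    Σ (Fin (suc N)) (λ u → deg G u ≤ δ N × N ≤ P * cnt (λ i → mem (punchIn u i)))
  deletable-vertex {N} m G mem cm free le eqD with any? (λ u → (mem u Bool.≟ false) ×-dec (deg G u ≤? δ N))
  ... | yes (u , mu , du) =
    u , du , ≤-trans (n≤1+n N) (≤-trans le (≤-reflexive (cong (P *_) (trans (sym cm) (sym (cnt-remove-false mem u mu))))))
  ... | no noOut = inside m cm le
    where
    inside : ∀ m → cnt mem ≡ m → suc N ≤ P * m →
      Σ (Fin (suc N)) (λ u → deg G u ≤ δ N × N ≤ P * cnt (λ i → mem (punchIn u i)))
    inside zero _ le = ⊥-elim (<-irrefl refl (positive zero le))
    inside (suc m') cm le with N ≤? P * m'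
    ... | no N≰ = ⊥-elim (crowded-M m' G mem cm free le N≰ (λ u mu → ≰⇒> (λ d → noOut (u , mu , d)))
                                    (extremal-min-degree (suc m') G mem cm free le eqD))
    ... | yes N≤ with low-degree-vertex (suc m') G mem cm free le
    ... | (u , du) = u , du , ≤-trans N≤ (*-monoʳ-≤ P (s≤s⁻¹ (≤-trans (≤-reflexive (sym cm)) (cnt≤1+cnt-remove mem u))))

  module Step {N : ℕ} (m : ℕ) (G : Graph (suc N)) (mem : Fin (suc N) → Bool) (cm : cnt mem ≡ m)
    (free : KFree (suc P) G mem) (le : suc N ≤ P * m) (u : Fin (suc N)) (du : deg G u ≡ δ N)
    (σ : del G u ≅ TG N) where

    pi : Fin N → Fin (suc N)
    pi = punchIn u

    partOf : Fin N → ℕ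
    partOf i = toℕ (to σ i) % P

    Hits : Fin P → Set
    Hits c = Σ (Fin N) (λ i → adj G u (pi i) ≡ true × partOf i ≡ toℕ c)

    clique-from-parts : (w : Fin P → Fin N) → (∀ c → adj G u (pi (w c)) ≡ true) →
      (∀ c → partOf (w c) ≡ toℕ c) → Clique G (cons u (λ c → pi (w c)))
    clique-from-parts w wAdj wPart = clique-cons G u (λ c → pi (w c)) across
      (λ c → trans (adj-sym G (pi (w c)) u) (wAdj c))
      where
      across : Clique G (λ c → pi (w c))
      across a b a≢b = trans (sym (preserves σ (w a) (w b)))
        (cong not (trans (cong₂ eqb (wPart a) (wPart b)) (eqb-≢ (toℕ a) (toℕ b) (λ q → a≢b (toℕ-injective q)))))

    -- If u ∉ M then u has a neighbour in M: otherwise all m vertices of M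
    -- are among the ⌊N/P⌋ + 1 non-neighbours of u, while ⌊N/P⌋ < m.
    neighbour-in-M : mem u ≡ false → Σ (Fin N) (λ i → adj G u (pi i) ≡ true × mem (pi i) ≡ true)
    neighbour-in-M mu with any? (λ i → (adj G u (pi i) Bool.≟ true) ×-dec (mem (pi i) Bool.≟ true))
    ... | yes found = found
    ... | no none = ⊥-elim (<-irrefl refl (≤-<-trans m≤q q<m))
      where
      outside : ∀ i → ind (mem (pi i)) ≤ ind (not (adj G u (pi i)))
      outside i with adj G u (pi i) in ai | mem (pi i) in mi
      ... | false | _ = ind≤1 _
      ... | true | false = z≤n
      ... | true | true = ⊥-elim (none (i , ai , mi))
      nd-u : nd G u ≡ suc (cnt (λ i → not (adj G u (pi i))))
      nd-u = trans (cnt-remove _ u) (cong (λ b → ind (not b) + cnt (λ i → not (adj G u (pi i)))) (adj-irrefl G u))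
      nd-u' : nd G u ≡ suc (N / P)
      nd-u' = +-cancelʳ-≡ (deg G u) _ _ (trans (nd+deg G u)
                (sym (cong suc (trans (+-comm (N / P) (deg G u)) (trans (cong (_+ N / P) du) (δ+quot N))))))
      m≤q : m ≤ N / P
      m≤q = begin
        m                                 ≡⟨ trans (cnt-remove-false mem u mu) cm ⟨
        cnt (λ i → mem (pi i))            ≤⟨ ∑-mono outside ⟩
        cnt (λ i → not (adj G u (pi i)))  ≡⟨ suc-injective (trans (sym nd-u) nd-u') ⟩
        N / P                             ∎
        where open ≤-Reasoning
      q<m : N / P < m
      q<m = *-cancelˡ-< P (N / P) m (≤-trans (s≤s (P*quot≤ N)) le)

    all-parts-hit-impossible : (∀ c → Hits c) → ⊥
    all-parts-hit-impossible hit with mem u in mu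
    ... | true = free (cons u (λ c → pi (proj₁ (hit c))))
                      (clique-from-parts (λ c → proj₁ (hit c)) (λ c → proj₁ (proj₂ (hit c))) (λ c → proj₂ (proj₂ (hit c))))
                      (zero , mu)
    ... | false with neighbour-in-M mu
    ... | (i0 , a0 , m0) = free (cons u (λ c → pi (proj₁ (rep c))))
            (clique-from-parts (λ c → proj₁ (rep c)) (λ c → proj₁ (proj₂ (rep c))) (λ c → proj₁ (proj₂ (proj₂ (rep c)))))
            (suc c0 , proj₂ (proj₂ (proj₂ (rep c0))) (sym (toℕ-fromℕ< (m%n<n (toℕ (to σ i0)) P))))
      where
      -- A neighbour in each part, taking i0 ∈ M in its own part.
      rep : (c : Fin P) → Σ (Fin N) (λ i → adj G u (pi i) ≡ true × partOf i ≡ toℕ c × (partOf i0 ≡ toℕ c → mem (pi i) ≡ true))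
      rep c with partOf i0 ℕ.≟ toℕ c
      ... | yes q = i0 , a0 , q , (λ _ → m0)
      ... | no q = proj₁ (hit c) , proj₁ (proj₂ (hit c)) , proj₂ (proj₂ (hit c)) , (λ q' → ⊥-elim (q q'))
      c0 : Fin P
      c0 = fromℕ< (m%n<n (toℕ (to σ i0)) P)

    -- If u misses part c, then u is adjacent to everything outside part c
    -- (its degree δ N leaves no room), and part c is a smallest part.
    missing-part-shape : (c : Fin P) → ¬ Hits c →
      (∀ i → adj G u (pi i) ≡ not (eqb (toℕ c) (partOf i))) × N % P ≤ toℕ c
    missing-part-shape c noHit = (λ i → ind-injective _ _ (∑-mono-tight nbr⊆ outside≤nbr i)) , proj₁ short
      where
      nbr⊆ : ∀ i → ind (adj G u (pi i)) ≤ ind (not (eqb (toℕ c) (partOf i)))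
      nbr⊆ i with adj G u (pi i) in ai
      ... | false = z≤n
      ... | true = ≤-reflexive (sym (cong (λ b → ind (not b)) (eqb-≢ (toℕ c) (partOf i) (λ q → noHit (i , ai , sym q)))))
      nbrs outside inside : ℕ
      nbrs = cnt (λ i → adj G u (pi i))
      outside = cnt (λ i → not (eqb (toℕ c) (partOf i)))
      inside = cnt (λ i → eqb (toℕ c) (partOf i))
      nbrs≡ : nbrs ≡ δ N
      nbrs≡ = trans (sym (deg-remove G u)) du
      inside≡ : inside ≡ partSize (toℕ c) N
      inside≡ = ∑-perm (λ j → ind (eqb (toℕ c) (toℕ j % P))) (to σ) (from σ) (from-to σ) (to-from σ)
      short : N % P ≤ toℕ c × partSize (toℕ c) N ≡ N / P
      short = partSize-min (toℕ c) N (toℕ<n c) (+-cancelˡ-≤ (δ N) _ _ (begin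
        δ N + partSize (toℕ c) N   ≡⟨ cong₂ _+_ nbrs≡ inside≡ ⟨
        nbrs + inside              ≤⟨ +-monoˡ-≤ inside (∑-mono nbr⊆) ⟩
        outside + inside           ≡⟨ cnt-not (λ i → eqb (toℕ c) (partOf i)) ⟩
        N                          ≡⟨ δ+partSize N ⟨
        δ N + partSize (N % P) N   ∎))
        where open ≤-Reasoning
      outside≤nbr : outside ≤ nbrs
      outside≤nbr = +-cancelʳ-≤ inside _ _ (≤-reflexive (begin
        outside + inside           ≡⟨ cnt-not (λ i → eqb (toℕ c) (partOf i)) ⟩
        N                          ≡⟨ δ+quot N ⟨
        δ N + N / P                ≡⟨ cong₂ _+_ nbrs≡ (trans inside≡ (proj₂ short)) ⟨
        nbrs + inside              ∎))
        where open ≡-Reasoning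

    -- Then G ≅ T_r(N + 1): move part c to the part of the new vertex and glue u to it.
    missing-part-iso : (c : Fin P) → ¬ Hits c → G ≅ TG (suc N)
    missing-part-iso c noHit = Glue.iso G (TG (suc N)) u (fromℕ N) σ' matches
      where
      shape = missing-part-shape c noHit
      open PartSwap κ N (toℕ c) (toℕ<n c) (proj₂ shape)
      σ' : del G u ≅ del (TG (suc N)) (fromℕ N)
      σ' = iso-trans (iso-trans σ τ-auto) (iso-same-adj (λ i j → del-last N i j))
      matches : ∀ i → adj G u (pi i) ≡ adj (TG (suc N)) (fromℕ N) (punchIn (fromℕ N) (to σ' i))
      matches i = trans (proj₁ shape i) (cong not (trans (sym (eqb-inv sw sw-inv (toℕ c) (partOf i)))
                    (trans (cong₂ eqb sw-c (sym (τ-part (to σ i))))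
                      (cong₂ (λ a b → eqb (a % P) (b % P)) (sym (toℕ-fromℕ N)) (sym (punchIn-last N (τ (to σ i))))))))

  Unique : ℕ → Set
  Unique n = ∀ m (G : Graph n) (mem : Fin n → Bool) → cnt mem ≡ m → KFree (suc P) G mem →
    n ≤ P * m → D G ≡ DT n → G ≅ TG n

  unique : ∀ n → Unique n
  unique zero m G mem cm free le eqD = iso-same-adj (λ ())
  unique (suc N) m G mem cm free le eqD with deletable-vertex m G mem cm free le eqD
  ... | (u , du , N≤) = glued
    where
    mem' : Fin N → Bool
    mem' i = mem (punchIn u i)
    free' = KFree-del G mem u free
    tight = split-eq (D (del G u)) (deg G u + deg G u) (DT N) (δ N + δ N)
              (trans (sym (D-del G u)) (trans eqD (DT-suc N)))
              (proj₁ (bound N (cnt mem') (del G u) mem' refl free') N≤) (+-mono-≤ du du)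
    du' : deg G u ≡ δ N
    du' = ≤-antisym du (halve (δ N) (deg G u) (≤-reflexive (sym (proj₂ tight))))
    open Step m G mem cm free le u du' (unique N (cnt mem') (del G u) mem' refl free' N≤ (proj₁ tight))
    glued : G ≅ TG (suc N)
    glued with all? (λ c → any? (λ i → (adj G u (pi i) Bool.≟ true) ×-dec (partOf i ℕ.≟ toℕ c)))
    ... | yes hit = ⊥-elim (all-parts-hit-impossible hit)
    ... | no notAll with ¬∀⟶∃¬ P _ (λ c → any? (λ i → (adj G u (pi i) Bool.≟ true) ×-dec (partOf i ℕ.≟ toℕ c))) notAll
    ...   | (c , noHit) = missing-part-iso c noHit

∣∣≡cnt : ∀ {n} (M : Subset n) → ∣ M ∣ ≡ cnt (lookup M)
∣∣≡cnt [] = sym (∑-empty _)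
∣∣≡cnt (true ∷ M) = trans (cong suc (∣∣≡cnt M)) (sym (∑-suc (λ i → ind (lookup (true ∷ M) i))))
∣∣≡cnt (false ∷ M) = trans (∣∣≡cnt M) (sym (∑-suc (λ i → ind (lookup (false ∷ M) i))))

-- A clique of order r meeting M is a copy of K_r intersecting M (a map onto
-- a clique is injective because G has no loops).
KFree-from-copies : ∀ {r n} (G : Graph n) (M : Subset n) →
  ((K : Copy-K r G) → ¬ Intersects K M) → KFree r G (lookup M)
KFree-from-copies G M noCopy xs cl (a , ma) =
  noCopy (record { emb = xs ; emb-inj = injective ; emb-adj = cl }) (a , lookup⇒[]= (xs a) M ma)
  where
  injective : ∀ a b → xs a ≡ xs b → a ≡ b
  injective a b eq with a Fin.≟ b
  ... | yes a≡b = a≡b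
  ... | no a≢b with trans (sym (adj-irrefl G (xs b))) (trans (cong (λ z → adj G z (xs b)) (sym eq)) (cl a b a≢b))
  ... | ()

module Regimes (κ : ℕ) where
  open TuranGraph κ
  open EdgeBound κ
  open Uniqueness κ

  turan-regime : ∀ {n} m (G : Graph n) (M : Subset n) → ∣ M ∣ ≡ m →
    ((K : Copy-K (suc P) G) → ¬ Intersects K M) → n ≤ P * m →
    e G ≤ t (suc P) n × (e G ≡ t (suc P) n → G ≅ T (suc P) n)
  turan-regime {n} m G M cM noCopy n≤ =
      halve (e G) (t (suc P) n) (≤-trans (≤-reflexive (sym (D≡2e G))) (≤-trans D≤ (≤-reflexive (D≡2e (TG n)))))
    , λ eq → unique n m G (lookup M) cm free n≤ (trans (D≡2e G) (trans (cong₂ _+_ eq eq) (sym (D≡2e (TG n)))))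
    where
    cm = trans (sym (∣∣≡cnt M)) cM
    free = KFree-from-copies G M noCopy
    D≤ = proj₁ (bound n m G (lookup M) cm free) n≤

  sparse-regime : ∀ {n} m (G : Graph n) (M : Subset n) → ∣ M ∣ ≡ m →
    ((K : Copy-K (suc P) G) → ¬ Intersects K M) → ¬ (n ≤ P * m) →
    e G ≤ (n C 2 + P * (suc m C 2)) ∸ n * m
  sparse-regime {n} m G M cM noCopy n≰ = m+n≤o⇒m≤o∸n (e G) (halve _ _ (begin
    (e G + n * m) + (e G + n * m)              ≡⟨ regroup (e G) (n * m) ⟩
    (e G + e G) + 2 * (n * m)                  ≡⟨ cong (_+ 2 * (n * m)) (D≡2e G) ⟨
    D G + 2 * (n * m)                          ≤⟨ proj₂ (bound n m G (lookup M) cm free) (<⇒≤ (≰⇒> n≰)) ⟩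
    2 * (c2 n + P * c2 (suc m))                ≡⟨ cong₂ (λ a b → 2 * (a + P * b)) (nC2≡c2 n) (nC2≡c2 (suc m)) ⟨
    2 * (n C 2 + P * (suc m C 2))              ≡⟨ double (n C 2 + P * (suc m C 2)) ⟩
    (n C 2 + P * (suc m C 2)) + (n C 2 + P * (suc m C 2)) ∎))
    where
    open ≤-Reasoning
    cm = trans (sym (∣∣≡cnt M)) cM
    free = KFree-from-copies G M noCopy
    regroup : ∀ a b → (a + b) + (a + b) ≡ (a + a) + 2 * b
    regroup = solve-∀
    double : ∀ x → 2 * x ≡ x + x
    double = solve-∀

theorem1p2 : (r n m : ℕ) → 3 ≤ r → 1 ≤ m → m ≤ n →
    (G : Graph n) (M : Subset n) → ∣ M ∣ ≡ m →
    ((K : Copy-K r G) → ¬ Intersects K M) →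
    (e G ≤ t₂ r n m) × (n ≤ (r ∸ 1) * m → e G ≡ t₂ r n m → G ≅ T r n)
theorem1p2 (suc zero) n m (s≤s ()) _ _ G M cM noCopy
theorem1p2 (suc (suc zero)) n m (s≤s (s≤s ())) _ _ G M cM noCopy
theorem1p2 (suc (suc (suc κ))) n m _ _ _ G M cM noCopy with n ≤? suc (suc κ) * m
... | yes n≤ = proj₁ regime , λ _ → proj₂ regime
  where regime = Regimes.turan-regime κ m G M cM noCopy n≤
... | no n≰ = Regimes.sparse-regime κ m G M cM noCopy n≰ , λ n≤ _ → ⊥-elim (n≰ n≤)
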